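{- Let $q$ be a prime power, let $\mu,\nu\in\mathbb{F}_q[x]$ be polynomials of degree one, and let $G\in\mathbb{F}_q[x]$ have degree larger than $1$ and coprime to $q$. If both $G$ and $\mu\circ G\circ\nu$ are odd polynomials, then $\nu(0)=0$.
   Context: A polynomial is called odd if all of its terms (monomials with nonzero coefficient) have odd degree. Here $\circ$ denotes composition of polynomials. -}

module Defs where

open import Level using (Level; _⊔_)
open import Algebra.Bundles using (CommutativeRing)
open import Data.Nat using (ℕ; zero; suc; _<_; _^_)
import Data.Nat as ℕ
open import Data.Nat.Primality using (Prime)
open import Data.Fin using (Fin)
open import Data.List using (List; []; _∷_; [_])
open import Data.Product using (Σ; ∃; _×_)
open import Relation.Nullary using (¬_)
open import Relation.Binary.PropositionalEquality as ≡ using (_≡_)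
open import Function.Bundles using (Bijection)

IsPrimePower : ℕ → Set
IsPrimePower q = ∃ λ p → ∃ λ k → Prime p × q ≡ p ^ suc k

record IsField {c ℓ : Level} (R : CommutativeRing c ℓ) : Set (c ⊔ ℓ) where
  open CommutativeRing R
  field
    0≉1 : ¬ (0# ≈ 1#)
    inverse : ∀ x → ¬ (x ≈ 0#) → ∃ λ y → x * y ≈ 1#

record IsFiniteField {c ℓ : Level} (R : CommutativeRing c ℓ) (q : ℕ) : Set (c ⊔ ℓ) where
  open CommutativeRing R
  field
    isField : IsField R
    card    : Bijection setoid (≡.setoid (Fin q))

-- Polynomials over a commutative ring R, as coefficient lists (constant term first).
module Poly {c ℓ : Level} (R : CommutativeRing c ℓ) where
  open CommutativeRing R renaming (Carrier to A)

  Pol : Set c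
  Pol = List A

  coeff : Pol → ℕ → A
  coeff []      _       = 0#
  coeff (a ∷ p) zero    = a
  coeff (a ∷ p) (suc i) = coeff p i

  eval : Pol → A → A
  eval []      x = 0#
  eval (a ∷ p) x = a + x * eval p x

  infixl 6 _+P_
  infixl 7 _*P_ _·P_

  _+P_ : Pol → Pol → Pol
  []      +P q       = q
  (a ∷ p) +P []      = a ∷ p
  (a ∷ p) +P (b ∷ q) = (a + b) ∷ (p +P q)

  _·P_ : A → Pol → Pol
  a ·P []      = []
  a ·P (b ∷ p) = (a * b) ∷ (a ·P p)

  _*P_ : Pol → Pol → Pol
  []      *P q = []
  (a ∷ p) *P q = (a ·P q) +P (0# ∷ (p *P q))

  infixr 9 _∘P_
  _∘P_ : Pol → Pol → Pol
  []      ∘P r = []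
  (a ∷ p) ∘P r = [ a ] +P (r *P (p ∘P r))

  HasDegree : Pol → ℕ → Set ℓ
  HasDegree p n = (¬ (coeff p n ≈ 0#)) × (∀ m → n < m → coeff p m ≈ 0#)

  Odd : Pol → Set ℓ
  Odd p = ∀ d → ¬ (coeff p d ≈ 0#) → ∃ λ k → d ≡ suc (2 ℕ.* k)

module Submission where

-- Let G be odd of degree n ≥ 2 with n invertible in F, and let μ = c + d x,
-- ν = a + b x (d, b ≠ 0).  Being odd, n is odd, so n - 1 is even and the
-- coefficients of x^(n-1) in G and in H = μ ∘ G ∘ ν both vanish.  Expanding
-- (a + b x)^k, the coefficient of x^(n-1) in G ∘ ν is
--   g_(n-1) b^(n-1) + n g_n a b^(n-1),
-- and composing with μ multiplies every non-constant coefficient by d.  Hence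
-- d · n g_n a b^(n-1) = 0, and since F has no zero divisors and n, g_n, b, d
-- are nonzero, a = ν(0) = 0.

open import Defs
open import Level using (Level)
open import Algebra.Bundles using (AbelianGroup; CommutativeRing)
open import Data.Nat using (ℕ; _<_)
open import Data.Nat.Coprimality using (Coprime)
open import Data.Product using (∃; _×_)

open import Data.Nat using (zero; suc; s≤s; z≤n)
import Data.Nat as ℕ
open import Data.Nat.Properties using (suc-injective; even≢odd; m<n⇒m<1+n; n<1+n)
open import Data.Nat.Coprimality using (coprime-Bézout)
open import Data.Nat.GCD using (module Bézout)
open import Data.Fin using (Fin; _≟_)
open import Data.Fin.Permutation using (permutation)
open import Data.List using ([]; _∷_; [_])
open import Data.Product using (Σ; _,_; proj₁; proj₂)
open import Data.Empty using (⊥-elim)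
open import Relation.Nullary using (¬_; Dec; yes; no)
open import Relation.Nullary.Decidable using (map′)
open import Relation.Binary.Bundles using (Setoid)
open import Relation.Binary.PropositionalEquality as ≡ using (_≡_)
open import Function.Bundles using (Bijection; Inverse)
open import Function.Properties.Bijection using (Bijection⇒Inverse)

finite-decidable : ∀ {a ℓ} {S : Setoid a ℓ} {q : ℕ} →
                   Bijection S (≡.setoid (Fin q)) → ∀ x y → Dec (Setoid._≈_ S x y)
finite-decidable card x y = map′ injective cong (to x ≟ to y)
  where open Bijection card

module FiniteAbelianGroup {a ℓ} (G : AbelianGroup a ℓ) where
  open AbelianGroup G
  open import Algebra.Properties.Monoid.Mult monoid using () renaming (_×_ to _×ₙ_)
  open import Algebra.Properties.CommutativeMonoid.Sum commutativeMonoid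
    using (sum; sum-permute; sum-cong-≋; ∑-distrib-+; sum-replicate)
  open import Algebra.Properties.Group group using (identityʳ-unique)
  open import Relation.Binary.Reasoning.Setoid setoid

  -- In an abelian group with q elements every x satisfies q × x ≈ ε: translation
  -- by x permutes the elements, so their sum S satisfies S ∙ q × x ≈ S.
  order-annihilates : ∀ {q} → Bijection setoid (≡.setoid (Fin q)) → ∀ x → q ×ₙ x ≈ ε
  order-annihilates {q} card x = identityʳ-unique S (q ×ₙ x) (sym translated-sum)
    where
    open Inverse (Bijection⇒Inverse card)
      using (to; from; to-cong) renaming (inverseˡ to to-from; inverseʳ to from-to-≈)

    from-to : ∀ y → from (to y) ≈ y
    from-to y = from-to-≈ ≡.refl

    translate : Carrier → Fin q → Fin q
    translate y i = to (from i ∙ y)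

    translate-cancel : ∀ y z → y ∙ z ≈ ε → ∀ i → translate z (translate y i) ≡ i
    translate-cancel y z y∙z≈ε i = ≡.trans (to-cong (begin
      from (to (from i ∙ y)) ∙ z  ≈⟨ ∙-congʳ (from-to _) ⟩
      (from i ∙ y) ∙ z            ≈⟨ assoc _ _ _ ⟩
      from i ∙ (y ∙ z)            ≈⟨ ∙-congˡ y∙z≈ε ⟩
      from i ∙ ε                  ≈⟨ identityʳ _ ⟩
      from i                      ∎)) (to-from refl)

    S : Carrier
    S = sum from

    translated-sum : S ≈ S ∙ q ×ₙ x
    translated-sum = begin
      S                                 ≈⟨ sum-permute from (permutation (translate x) (translate (x ⁻¹))
                                             (translate-cancel (x ⁻¹) x (inverseˡ x))
                                             (translate-cancel x (x ⁻¹) (inverseʳ x))) ⟩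
      sum (λ i → from (translate x i))  ≈⟨ sum-cong-≋ {q} (λ i → from-to (from i ∙ x)) ⟩
      sum (λ i → from i ∙ x)            ≈⟨ ∑-distrib-+ {q} from (λ _ → x) ⟩
      S ∙ sum {q} (λ _ → x)             ≈⟨ ∙-congˡ (sum-replicate q) ⟩
      S ∙ q ×ₙ x                        ∎

module Characteristic {c ℓ} (R : CommutativeRing c ℓ) where
  open CommutativeRing R
  open import Algebra.Properties.Semiring.Mult semiring
    using (×1-homo-*) renaming (_×_ to _×ₙ_)

  multiple-vanishes : ∀ x k → k ×ₙ 1# ≈ 0# → (x ℕ.* k) ×ₙ 1# ≈ 0#
  multiple-vanishes x k k≈0 = trans (×1-homo-* x k) (trans (*-congˡ k≈0) (zeroʳ _))

  successor-vanishes : ∀ u v → 1 ℕ.+ u ≡ v → u ×ₙ 1# ≈ 0# → v ×ₙ 1# ≈ 0# → 0# ≈ 1#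
  successor-vanishes u v ≡.refl u≈0 v≈0 =
    trans (sym v≈0) (trans (+-congˡ u≈0) (+-identityʳ 1#))

  -- In a nontrivial ring with q × 1 ≈ 0, every n coprime to q has n × 1 ≉ 0
  -- (by Bézout, otherwise 1 would be a combination of n and q).
  coprime-nonvanishing : ∀ {n q} → ¬ (0# ≈ 1#) → q ×ₙ 1# ≈ 0# → Coprime n q → ¬ (n ×ₙ 1# ≈ 0#)
  coprime-nonvanishing {n} {q} 0≉1 q≈0 n⊥q n≈0 with coprime-Bézout n⊥q
  ... | Bézout.+- x y eq =
    0≉1 (successor-vanishes (y ℕ.* q) (x ℕ.* n) eq (multiple-vanishes y q q≈0) (multiple-vanishes x n n≈0))
  ... | Bézout.-+ x y eq =
    0≉1 (successor-vanishes (x ℕ.* n) (y ℕ.* q) eq (multiple-vanishes x n n≈0) (multiple-vanishes y q q≈0))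

module FieldArithmetic {c ℓ} {F : CommutativeRing c ℓ} (isField : IsField F) where
  open CommutativeRing F
  open IsField isField
  open import Algebra.Properties.Semiring.Exp semiring using (_^_)
  open import Algebra.Solver.Ring.NaturalCoefficients.Default commutativeSemiring

  *-cancel-nonzero : ∀ {x y} → ¬ (x ≈ 0#) → x * y ≈ 0# → y ≈ 0#
  *-cancel-nonzero {x} {y} x≉0 xy≈0 with inverse x x≉0
  ... | z , xz≈1 = begin
    y              ≈⟨ sym (*-identityˡ y) ⟩
    1# * y         ≈⟨ *-congʳ (sym xz≈1) ⟩
    (x * z) * y    ≈⟨ solve 3 (λ x y z → (x :* z) :* y := z :* (x :* y)) refl x y z ⟩
    z * (x * y)    ≈⟨ *-congˡ xy≈0 ⟩
    z * 0#         ≈⟨ zeroʳ z ⟩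
    0#             ∎
    where open import Relation.Binary.Reasoning.Setoid setoid

  *-nonzero : ∀ {x y} → ¬ (x ≈ 0#) → ¬ (y ≈ 0#) → ¬ (x * y ≈ 0#)
  *-nonzero x≉0 y≉0 xy≈0 = y≉0 (*-cancel-nonzero x≉0 xy≈0)

  ^-nonzero : ∀ {x} → ¬ (x ≈ 0#) → ∀ k → ¬ (x ^ k ≈ 0#)
  ^-nonzero x≉0 zero    1≈0 = 0≉1 (sym 1≈0)
  ^-nonzero x≉0 (suc k) = *-nonzero x≉0 (^-nonzero x≉0 k)

module Coefficients {c ℓ} (R : CommutativeRing c ℓ) where
  open CommutativeRing R hiding (zero)
  open Poly R
  open import Algebra.Properties.Semiring.Mult semiring using () renaming (_×_ to _×ₙ_)
  open import Algebra.Properties.Semiring.Exp semiring using (_^_)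
  open import Algebra.Solver.Ring.NaturalCoefficients.Default commutativeSemiring
  open import Relation.Binary.Reasoning.Setoid setoid

  annihʳ : ∀ y {x} → x ≈ 0# → y * x ≈ 0#
  annihʳ y x≈0 = trans (*-congˡ x≈0) (zeroʳ y)

  annihˡ : ∀ y {x} → x ≈ 0# → x * y ≈ 0#
  annihˡ y x≈0 = trans (*-congʳ x≈0) (zeroˡ y)

  +-vanishes : ∀ {x y} → x ≈ 0# → y ≈ 0# → x + y ≈ 0#
  +-vanishes x≈0 y≈0 = trans (+-cong x≈0 y≈0) (+-identityʳ 0#)

  -- The polynomial is zero (all coefficients vanish; trailing zeros are allowed).
  Vanishes : Pol → Set ℓ
  Vanishes p = ∀ m → coeff p m ≈ 0#

  VanishesAbove : Pol → ℕ → Set ℓ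
  VanishesAbove p k = ∀ m → k < m → coeff p m ≈ 0#

  above-tail : ∀ {p₀ p k} → VanishesAbove (p₀ ∷ p) (suc k) → VanishesAbove p k
  above-tail above m k<m = above (suc m) (s≤s k<m)

  constant-tail : ∀ {p₀ p} → VanishesAbove (p₀ ∷ p) 0 → Vanishes p
  constant-tail above m = above (suc m) (s≤s z≤n)

  coeff-+P : ∀ p r m → coeff (p +P r) m ≈ coeff p m + coeff r m
  coeff-+P []      r       m       = sym (+-identityˡ _)
  coeff-+P (a ∷ p) []      m       = sym (+-identityʳ _)
  coeff-+P (a ∷ p) (b ∷ r) zero    = refl
  coeff-+P (a ∷ p) (b ∷ r) (suc m) = coeff-+P p r m

  coeff-·P : ∀ a p m → coeff (a ·P p) m ≈ a * coeff p m
  coeff-·P a []      m       = sym (zeroʳ a)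
  coeff-·P a (b ∷ p) zero    = refl
  coeff-·P a (b ∷ p) (suc m) = coeff-·P a p m

  coeff-*P-zero : ∀ a p r → coeff ((a ∷ p) *P r) zero ≈ a * coeff r zero
  coeff-*P-zero a p r = begin
    coeff ((a ·P r) +P (0# ∷ (p *P r))) zero  ≈⟨ coeff-+P (a ·P r) (0# ∷ (p *P r)) zero ⟩
    coeff (a ·P r) zero + 0#                  ≈⟨ +-identityʳ _ ⟩
    coeff (a ·P r) zero                       ≈⟨ coeff-·P a r zero ⟩
    a * coeff r zero                          ∎

  coeff-*P-suc : ∀ a p r m → coeff ((a ∷ p) *P r) (suc m) ≈ a * coeff r (suc m) + coeff (p *P r) m
  coeff-*P-suc a p r m = trans (coeff-+P (a ·P r) (0# ∷ (p *P r)) (suc m)) (+-congʳ (coeff-·P a r (suc m)))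

  coeff-∘P-zero : ∀ a p r → coeff ((a ∷ p) ∘P r) zero ≈ a + coeff (r *P (p ∘P r)) zero
  coeff-∘P-zero a p r = coeff-+P [ a ] (r *P (p ∘P r)) zero

  coeff-∘P-suc : ∀ a p r m → coeff ((a ∷ p) ∘P r) (suc m) ≈ coeff (r *P (p ∘P r)) (suc m)
  coeff-∘P-suc a p r m = trans (coeff-+P [ a ] (r *P (p ∘P r)) (suc m)) (+-identityˡ _)

  *P-vanishesˡ : ∀ p r → Vanishes p → Vanishes (p *P r)
  *P-vanishesˡ []      r p≈0 m       = refl
  *P-vanishesˡ (a ∷ p) r p≈0 zero    = trans (coeff-*P-zero a p r) (annihˡ _ (p≈0 zero))
  *P-vanishesˡ (a ∷ p) r p≈0 (suc m) = trans (coeff-*P-suc a p r m)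
    (+-vanishes (annihˡ _ (p≈0 zero)) (*P-vanishesˡ p r (λ k → p≈0 (suc k)) m))

  *P-vanishesʳ : ∀ p r → Vanishes r → Vanishes (p *P r)
  *P-vanishesʳ []      r r≈0 m       = refl
  *P-vanishesʳ (a ∷ p) r r≈0 zero    = trans (coeff-*P-zero a p r) (annihʳ a (r≈0 zero))
  *P-vanishesʳ (a ∷ p) r r≈0 (suc m) = trans (coeff-*P-suc a p r m)
    (+-vanishes (annihʳ a (r≈0 (suc m))) (*P-vanishesʳ p r r≈0 m))

  ∘P-vanishes : ∀ p r → Vanishes p → Vanishes (p ∘P r)
  ∘P-vanishes []      r p≈0 m       = refl
  ∘P-vanishes (a ∷ p) r p≈0 zero    = trans (coeff-∘P-zero a p r)
    (+-vanishes (p≈0 zero) (*P-vanishesʳ r (p ∘P r) (∘P-vanishes p r (λ k → p≈0 (suc k))) zero))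
  ∘P-vanishes (a ∷ p) r p≈0 (suc m) = trans (coeff-∘P-suc a p r m)
    (*P-vanishesʳ r (p ∘P r) (∘P-vanishes p r (λ k → p≈0 (suc k))) (suc m))

  IsConstant : Pol → Carrier → Set ℓ
  IsConstant s b = ∀ m → coeff s m ≈ coeff [ b ] m

  *P-constantˡ : ∀ b rest r → Vanishes rest → ∀ m → coeff ((b ∷ rest) *P r) m ≈ b * coeff r m
  *P-constantˡ b rest r rest≈0 zero    = coeff-*P-zero b rest r
  *P-constantˡ b rest r rest≈0 (suc m) = trans (coeff-*P-suc b rest r m)
    (trans (+-congˡ (*P-vanishesˡ rest r rest≈0 m)) (+-identityʳ _))

  *P-constantʳ : ∀ p s b → IsConstant s b → ∀ m → coeff (p *P s) m ≈ coeff p m * b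
  *P-constantʳ []      s b s≈b m       = sym (zeroˡ b)
  *P-constantʳ (a ∷ p) s b s≈b zero    = trans (coeff-*P-zero a p s) (*-congˡ (s≈b zero))
  *P-constantʳ (a ∷ p) s b s≈b (suc m) = trans (coeff-*P-suc a p s m)
    (trans (+-cong (annihʳ a (s≈b (suc m))) (*P-constantʳ p s b s≈b m)) (+-identityˡ _))

  affine-∘P : ∀ c d rest r → Vanishes rest →
              ∀ m → coeff ((c ∷ d ∷ rest) ∘P r) (suc m) ≈ coeff r (suc m) * d
  affine-∘P c d rest r rest≈0 m =
    trans (coeff-∘P-suc c (d ∷ rest) r m) (*P-constantʳ r ((d ∷ rest) ∘P r) d inner-constant (suc m))
    where
    inner-constant : IsConstant ((d ∷ rest) ∘P r) d
    inner-constant k = trans (coeff-+P [ d ] (r *P (rest ∘P r)) k)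
      (trans (+-congˡ (*P-vanishesʳ r (rest ∘P r) (∘P-vanishes rest r rest≈0) k)) (+-identityʳ _))

  eval-zero : ∀ p → eval p 0# ≈ coeff p zero
  eval-zero []      = refl
  eval-zero (a ∷ p) = trans (+-congˡ (zeroˡ _)) (+-identityʳ a)

  odd-even-coeff : (∀ x → Dec (x ≈ 0#)) → ∀ p → Odd p → ∀ {j} k → j ≡ 2 ℕ.* k → coeff p j ≈ 0#
  odd-even-coeff dec p p-odd {j} k j≡2k with dec (coeff p j)
  ... | yes pⱼ≈0 = pⱼ≈0
  ... | no  pⱼ≉0 with p-odd j pⱼ≉0
  ...   | k′ , j≡1+2k′ = ⊥-elim (even≢odd k k′ (≡.trans (≡.sym j≡2k) j≡1+2k′))

  module LinearSubstitution (a b : Carrier) (rest : Pol) (rest≈0 : Vanishes rest) where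
    ν : Pol
    ν = a ∷ b ∷ rest

    ν-*P-suc : ∀ r m → coeff (ν *P r) (suc m) ≈ a * coeff r (suc m) + b * coeff r m
    ν-*P-suc r m = trans (coeff-*P-suc a (b ∷ rest) r m) (+-congˡ (*P-constantˡ b rest r rest≈0 m))

    ∘ν-zero : ∀ p₀ p → coeff ((p₀ ∷ p) ∘P ν) zero ≈ p₀ + a * coeff (p ∘P ν) zero
    ∘ν-zero p₀ p = trans (coeff-∘P-zero p₀ p ν) (+-congˡ (coeff-*P-zero a (b ∷ rest) (p ∘P ν)))

    ∘ν-suc : ∀ p₀ p m → coeff ((p₀ ∷ p) ∘P ν) (suc m) ≈ a * coeff (p ∘P ν) (suc m) + b * coeff (p ∘P ν) m
    ∘ν-suc p₀ p m = trans (coeff-∘P-suc p₀ p ν m) (ν-*P-suc (p ∘P ν) m)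

    ∘ν-vanishesAbove : ∀ p k → VanishesAbove p k → VanishesAbove (p ∘P ν) k
    ∘ν-vanishesAbove []       k       above m       _ = refl
    ∘ν-vanishesAbove (p₀ ∷ p) k       above zero    ()
    ∘ν-vanishesAbove (p₀ ∷ p) zero    above (suc m) _ = trans (∘ν-suc p₀ p m)
      (+-vanishes (annihʳ a (p∘ν≈0 (suc m))) (annihʳ b (p∘ν≈0 m)))
      where p∘ν≈0 = ∘P-vanishes p ν (constant-tail above)
    ∘ν-vanishesAbove (p₀ ∷ p) (suc k) above (suc m) (s≤s k<m) = trans (∘ν-suc p₀ p m)
      (+-vanishes (annihʳ a (below (suc m) (m<n⇒m<1+n k<m))) (annihʳ b (below m k<m)))
      where below = ∘ν-vanishesAbove p k (above-tail above)

    ∘ν-leading : ∀ p k → VanishesAbove p k → coeff (p ∘P ν) k ≈ coeff p k * b ^ k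
    ∘ν-leading []       k       above = sym (zeroˡ _)
    ∘ν-leading (p₀ ∷ p) zero    above = begin
      coeff ((p₀ ∷ p) ∘P ν) zero   ≈⟨ ∘ν-zero p₀ p ⟩
      p₀ + a * coeff (p ∘P ν) zero ≈⟨ +-congˡ (annihʳ a (∘P-vanishes p ν (constant-tail above) zero)) ⟩
      p₀ + 0#                      ≈⟨ +-identityʳ p₀ ⟩
      p₀                           ≈⟨ sym (*-identityʳ p₀) ⟩
      p₀ * 1#                      ∎
    ∘ν-leading (p₀ ∷ p) (suc k) above = begin
      coeff ((p₀ ∷ p) ∘P ν) (suc k)                     ≈⟨ ∘ν-suc p₀ p k ⟩
      a * coeff (p ∘P ν) (suc k) + b * coeff (p ∘P ν) k ≈⟨ +-cong top-vanishes (*-congˡ (∘ν-leading p k (above-tail above))) ⟩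
      0# + b * (coeff p k * b ^ k)                      ≈⟨ solve 3 (λ b y B → con 0 :+ b :* (y :* B) := y :* (b :* B))
                                                               refl b (coeff p k) (b ^ k) ⟩
      coeff p k * (b * b ^ k)                           ∎
      where
      top-vanishes : a * coeff (p ∘P ν) (suc k) ≈ 0#
      top-vanishes = annihʳ a (∘ν-vanishesAbove p k (above-tail above) (suc k) (n<1+n k))

    -- The coefficient just below the top of p ∘ ν is p_j b^j + (j+1) p_(j+1) a b^j,
    -- the subleading term of the binomial expansion of (a + b x)^(j+1).
    ∘ν-subleading : ∀ p j → VanishesAbove p (suc j) →
      coeff (p ∘P ν) j ≈ coeff p j * b ^ j + (suc j ×ₙ 1#) * (coeff p (suc j) * a * b ^ j)
    ∘ν-subleading []       j       above =
      solve 3 (λ B t a → con 0 := con 0 :* B :+ t :* (con 0 :* a :* B)) refl (b ^ j) (suc j ×ₙ 1#) a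
    ∘ν-subleading (p₀ ∷ p) zero    above = begin
      coeff ((p₀ ∷ p) ∘P ν) zero    ≈⟨ ∘ν-zero p₀ p ⟩
      p₀ + a * coeff (p ∘P ν) zero  ≈⟨ +-congˡ (*-congˡ (∘ν-leading p zero (above-tail above))) ⟩
      p₀ + a * (coeff p zero * 1#)  ≈⟨ solve 3 (λ p₀ a y → p₀ :+ a :* (y :* con 1)
                                            := p₀ :* con 1 :+ (con 1 :+ con 0) :* (y :* a :* con 1))
                                            refl p₀ a (coeff p zero) ⟩
      p₀ * 1# + (1# + 0#) * (coeff p zero * a * 1#) ∎
    ∘ν-subleading (p₀ ∷ p) (suc i) above = begin
      coeff ((p₀ ∷ p) ∘P ν) (suc i)                     ≈⟨ ∘ν-suc p₀ p i ⟩
      a * coeff (p ∘P ν) (suc i) + b * coeff (p ∘P ν) i ≈⟨ +-cong (*-congˡ (∘ν-leading p (suc i) (above-tail above)))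
                                                                   (*-congˡ (∘ν-subleading p i (above-tail above))) ⟩
      a * (y * (b * B)) + b * (z * B + t * (y * a * B))  ≈⟨ solve 6 (λ a b B y z t →
                                                               a :* (y :* (b :* B)) :+ b :* (z :* B :+ t :* (y :* a :* B))
                                                            := z :* (b :* B) :+ (con 1 :+ t) :* (y :* a :* (b :* B)))
                                                            refl a b B y z t ⟩
      z * (b * B) + (1# + t) * (y * a * (b * B))          ∎
      where
      B = b ^ i
      y = coeff p (suc i)
      z = coeff p i
      t = suc i ×ₙ 1#

module OddComposition {c ℓ} (F : CommutativeRing c ℓ) {q : ℕ} (finite : IsFiniteField F q) where
  open CommutativeRing F hiding (zero)
  open Poly F
  open Coefficients F
  open IsFiniteField finite
  open IsField isField using (0≉1)
  open FieldArithmetic isField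
  open import Algebra.Properties.Semiring.Mult semiring using () renaming (_×_ to _×ₙ_)
  open import Algebra.Properties.Semiring.Exp semiring using (_^_)
  open import Algebra.Solver.Ring.NaturalCoefficients.Default commutativeSemiring
  open import Relation.Binary.Reasoning.Setoid setoid

  -- Every n coprime to q = |F| is nonzero in F, since q · 1 = 0.
  coprime-nonzero : ∀ {n} → Coprime n q → ¬ (n ×ₙ 1# ≈ 0#)
  coprime-nonzero = Characteristic.coprime-nonvanishing F 0≉1
    (FiniteAbelianGroup.order-annihilates +-abelianGroup card 1#)

  vanishing? : ∀ x → Dec (x ≈ 0#)
  vanishing? x = finite-decidable card x 0#

  degree-one-form : ∀ p → HasDegree p 1 →
                    Σ Carrier λ c → Σ Carrier λ d → Σ Pol λ rest → p ≡ c ∷ d ∷ rest × Vanishes rest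
  degree-one-form []             (d≉0 , _)   = ⊥-elim (d≉0 refl)
  degree-one-form (c ∷ [])       (d≉0 , _)   = ⊥-elim (d≉0 refl)
  degree-one-form (c ∷ d ∷ rest) (_ , above) = c , d , rest , ≡.refl , λ m → above (suc (suc m)) (s≤s (s≤s z≤n))

  constant-term-vanishes : (μ ν G : Pol) → HasDegree μ 1 → HasDegree ν 1 →
            (∃ λ n → HasDegree G n × 1 < n × Coprime n q) →
            Odd G → Odd (μ ∘P G ∘P ν) → eval ν 0# ≈ 0#
  constant-term-vanishes μ ν G μ-deg ν-deg (zero , _ , () , _)
  constant-term-vanishes μ ν G μ-deg ν-deg (suc zero , _ , s≤s () , _)
  constant-term-vanishes μ ν G μ-deg ν-deg (suc (suc i) , (gₙ≉0 , G-above) , _ , n⊥q) G-odd H-odd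
    with degree-one-form μ μ-deg | degree-one-form ν ν-deg
  ... | c , d , rμ , ≡.refl , rμ≈0 | a , b , rν , ≡.refl , rν≈0 =
    trans (eval-zero ν) (*-cancel-nonzero factor≉0 factor·a≈0)
    where
    open LinearSubstitution a b rν rν≈0 using (∘ν-subleading)
    j = suc i
    t = suc j ×ₙ 1#
    gₙ = coeff G (suc j)

    j-even : ∃ λ k → j ≡ 2 ℕ.* k
    j-even with G-odd (suc j) gₙ≉0
    ... | k , n≡1+2k = k , suc-injective n≡1+2k

    vanishes-at-j : ∀ p → Odd p → coeff p j ≈ 0#
    vanishes-at-j p p-odd = odd-even-coeff vanishing? p p-odd (proj₁ j-even) (proj₂ j-even)

    factor≉0 : ¬ (t * gₙ * b ^ j * d ≈ 0#)
    factor≉0 = *-nonzero (*-nonzero (*-nonzero (coprime-nonzero n⊥q) gₙ≉0)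
                                    (^-nonzero (proj₁ ν-deg) j))
                         (proj₁ μ-deg)

    factor·a≈0 : (t * gₙ * b ^ j * d) * a ≈ 0#
    factor·a≈0 = begin
      (t * gₙ * b ^ j * d) * a                        ≈⟨ solve 5 (λ t g a B d → (t :* g :* B :* d) :* a
                                                                 := (con 0 :* B :+ t :* (g :* a :* B)) :* d)
                                                                 refl t gₙ a (b ^ j) d ⟩
      (0# * b ^ j + t * (gₙ * a * b ^ j)) * d         ≈⟨ *-congʳ (+-congʳ (*-congʳ (sym (vanishes-at-j G G-odd)))) ⟩
      (coeff G j * b ^ j + t * (gₙ * a * b ^ j)) * d  ≈⟨ *-congʳ (sym (∘ν-subleading G j G-above)) ⟩
      coeff (G ∘P ν) j * d                            ≈⟨ sym (affine-∘P c d rμ (G ∘P ν) rμ≈0 i) ⟩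
      coeff (μ ∘P G ∘P ν) j                           ≈⟨ vanishes-at-j (μ ∘P G ∘P ν) H-odd ⟩
      0#                                              ∎

lemma2p10 : ∀ {c ℓ : Level} (q : ℕ) → IsPrimePower q →
    (F : CommutativeRing c ℓ) → IsFiniteField F q →
    let open CommutativeRing F in
    let open Poly F in
    (μ ν G : Pol) → HasDegree μ 1 → HasDegree ν 1 →
    (∃ λ n → HasDegree G n × 1 < n × Coprime n q) →
    Odd G → Odd (μ ∘P G ∘P ν) →
    eval ν 0# ≈ 0#
lemma2p10 q _ F finite = OddComposition.constant-term-vanishes F finite
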